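{- Let $\mathcal{D}=(\mathcal{P},\mathcal{B})$ be a Steiner $3$-design with $v$ points and block size $k$, and let $G\leq\mathrm{Aut}(\mathcal{D})$ act transitively on $\mathcal{B}$. If $H\neq 1$ is a subgroup of $G$ having an orbit $\Gamma$ on $\mathcal{P}$ with $|\Gamma|\geq 3$, then \[|\mathrm{Fix}_{\mathcal{P}}(H)|\leq \frac{2(v-k)}{k-2}+k-2,\] where $\mathrm{Fix}_{\mathcal{P}}(H)$ is the set of points of $\mathcal{P}$ fixed by every element of $H$.
   Context: A Steiner $3$-design $\mathcal{D}=(\mathcal{P},\mathcal{B})$ consists of a finite set $\mathcal{P}$ of $v$ points and a set $\mathcal{B}$ of $k$-element subsets of $\mathcal{P}$ (blocks) such that any $3$ distinct points lie in exactly one block. $\mathrm{Aut}(\mathcal{D})$ is the group of permutations of $\mathcal{P}$ mapping blocks to blocks. -}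

module Defs where

open import Level using (0ℓ)
open import Data.Nat using (ℕ)
open import Data.Fin using (Fin)
open import Data.Fin.Subset using (Subset; _∈_; ∣_∣)
open import Data.Fin.Permutation
  using (Permutation′; _⟨$⟩ʳ_; _⟨$⟩ˡ_; _≈_; id; flip; _∘ₚ_)
open import Data.Vec using (tabulate; lookup)
open import Data.Product using (Σ; _×_; ∃-syntax)
open import Relation.Binary.PropositionalEquality using (_≡_; _≢_)

record Steiner3Design (v k : ℕ) : Set₁ where
  field
    IsBlock    : Subset v → Set
    block-size : ∀ B → IsBlock B → ∣ B ∣ ≡ k
    steiner    : ∀ x y z → x ≢ y → x ≢ z → y ≢ z →
                 ∃[ B ] (IsBlock B × x ∈ B × y ∈ B × z ∈ B ×
                   (∀ B′ → IsBlock B′ → x ∈ B′ → y ∈ B′ → z ∈ B′ → B′ ≡ B))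

open Steiner3Design public

image : ∀ {v} → Permutation′ v → Subset v → Subset v
image g S = tabulate (λ y → lookup S (g ⟨$⟩ˡ y))

IsAut : ∀ {v k} → Steiner3Design v k → Permutation′ v → Set
IsAut D g = ∀ B → IsBlock D B → IsBlock D (image g B)

record IsSubgroup {v} (G : Permutation′ v → Set) : Set where
  field
    ≈-closed  : ∀ {g h} → g ≈ h → G g → G h
    id-closed : G id
    ∘-closed  : ∀ {g h} → G g → G h → G (g ∘ₚ h)
    ⁻¹-closed : ∀ {g} → G g → G (flip g)

_⊆ᴳ_ : ∀ {v} → (Permutation′ v → Set) → (Permutation′ v → Set) → Set
H ⊆ᴳ G = ∀ g → H g → G g

BlockTransitive : ∀ {v k} → Steiner3Design v k → (Permutation′ v → Set) → Set
BlockTransitive D G = ∀ B C → IsBlock D B → IsBlock D C →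
  ∃[ g ] (G g × image g B ≡ C)

Nontrivial : ∀ {v} → (Permutation′ v → Set) → Set
Nontrivial H = ∃[ h ] (H h × ∃[ x ] (h ⟨$⟩ʳ x ≢ x))

InOrbit : ∀ {v} → (Permutation′ v → Set) → Fin v → Fin v → Set
InOrbit H x y = ∃[ h ] (H h × h ⟨$⟩ʳ x ≡ y)

HasOrbit≥3 : ∀ {v} → (Permutation′ v → Set) → Set
HasOrbit≥3 H = ∃[ x ] ∃[ y ] ∃[ z ]
  (InOrbit H x y × InOrbit H x z × x ≢ y × x ≢ z × y ≢ z)

FixedBy : ∀ {v} → (Permutation′ v → Set) → Fin v → Set
FixedBy H x = ∀ h → H h → h ⟨$⟩ʳ x ≡ x

{-# OPTIONS --safe #-}
-- Let y = h₁ x and z = h₂ x be distinct points of an H-orbit and B₀ the block through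
-- x, y, z.  A block through x and three points fixed by H is the unique block through
-- those fixed points, hence H-invariant; so it contains y and z, i.e. it is B₀.
-- Fix a ∈ F.  Blocks through a and x pairwise meet only in {a, x}, so a set S of
-- points whose blocks through a and x are pairwise distinct has (k−2)|S| ≤ v−2.  This
-- applies to S = F ∖ B₀ when a ∈ B₀ (and |F ∩ B₀| ≤ k−3, as x, y, z ∉ F), and to
-- S = F ∖ {a} when F misses B₀ (and then k < v); both give the bound.
module Submission where

open import Defs
open import Data.Bool using (true; false)
open import Data.Empty using (⊥)
open import Data.Fin using (Fin; _≟_)
open import Data.Fin.Permutation using (Permutation′; _⟨$⟩ʳ_; _⟨$⟩ˡ_; inverseˡ)
open import Data.Fin.Subset using (Subset; _∈_; _∉_; _⊆_; ∣_∣; ⁅_⁆; _∪_; _∩_; _─_; _-_)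
open import Data.Fin.Subset.Properties
  using (∣p∣≤n; ∣⊥∣≡0; ∣⁅x⁆∣≡1; ∣p∩q∣≤∣q∣; x∈⁅x⁆; x∈⁅y⁆⇒x≡y; x≢y⇒x∉⁅y⁆;
         x∈p∪q⁺; x∈p∪q⁻; x∈p∩q⁺; x∈p∩q⁻; ∩-comm; p─q⊆p; x∈p∧x∉q⇒x∈p─q;
         x∈p∧x≢y⇒x∈p-y; x∈p⇒∣p-x∣<∣p∣; Empty-unique; nonempty?)
import Data.Fin.Properties as Fin
open import Data.Nat using (ℕ; zero; suc; _+_; _*_; _∸_; _≤_; _<_; z≤n; s≤s)
open import Data.Nat.Properties hiding (_≟_)
open import Data.Nat.Tactic.RingSolver using (solve-∀)
open import Data.Product using (_,_; proj₁; proj₂)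
open import Data.Sum using (inj₁; inj₂)
open import Data.Vec using ([]; _∷_; lookup; here; there)
open import Data.Vec.Properties using (lookup∘tabulate; []=⇒lookup; lookup⇒[]=)
open import Function using (_∘_; _∘₂_)
open import Relation.Binary.PropositionalEquality
open import Relation.Nullary using (yes; no; contradiction)

∣p∪q∣≡∣p∣+∣q∣ : ∀ {n} (p q : Subset n) → (∀ {i} → i ∈ p → i ∈ q → ⊥) → ∣ p ∪ q ∣ ≡ ∣ p ∣ + ∣ q ∣
∣p∪q∣≡∣p∣+∣q∣ []          []          _        = refl
∣p∪q∣≡∣p∣+∣q∣ (true ∷ p)  (true ∷ q)  disjoint = contradiction here (disjoint here)
∣p∪q∣≡∣p∣+∣q∣ (true ∷ p)  (false ∷ q) disjoint =
  cong suc (∣p∪q∣≡∣p∣+∣q∣ p q (λ i∈p i∈q → disjoint (there i∈p) (there i∈q)))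
∣p∪q∣≡∣p∣+∣q∣ (false ∷ p) (true ∷ q)  disjoint =
  trans (cong suc (∣p∪q∣≡∣p∣+∣q∣ p q (λ i∈p i∈q → disjoint (there i∈p) (there i∈q))))
        (sym (+-suc ∣ p ∣ ∣ q ∣))
∣p∪q∣≡∣p∣+∣q∣ (false ∷ p) (false ∷ q) disjoint =
  ∣p∪q∣≡∣p∣+∣q∣ p q (λ i∈p i∈q → disjoint (there i∈p) (there i∈q))

∣p∣≡∣p∩q∣+∣p─q∣ : ∀ {n} (p q : Subset n) → ∣ p ∣ ≡ ∣ p ∩ q ∣ + ∣ p ─ q ∣
∣p∣≡∣p∩q∣+∣p─q∣ []          []          = refl
∣p∣≡∣p∩q∣+∣p─q∣ (true ∷ p)  (true ∷ q)  = cong suc (∣p∣≡∣p∩q∣+∣p─q∣ p q)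
∣p∣≡∣p∩q∣+∣p─q∣ (true ∷ p)  (false ∷ q) =
  trans (cong suc (∣p∣≡∣p∩q∣+∣p─q∣ p q)) (sym (+-suc ∣ p ∩ q ∣ ∣ p ─ q ∣))
∣p∣≡∣p∩q∣+∣p─q∣ (false ∷ p) (true ∷ q)  = ∣p∣≡∣p∩q∣+∣p─q∣ p q
∣p∣≡∣p∩q∣+∣p─q∣ (false ∷ p) (false ∷ q) = ∣p∣≡∣p∩q∣+∣p─q∣ p q

∣p∣≤∣q∣+∣p─q∣ : ∀ {n} (p q : Subset n) → ∣ p ∣ ≤ ∣ q ∣ + ∣ p ─ q ∣
∣p∣≤∣q∣+∣p─q∣ p q = ≤-trans (≤-reflexive (∣p∣≡∣p∩q∣+∣p─q∣ p q)) (+-monoˡ-≤ ∣ p ─ q ∣ (∣p∩q∣≤∣q∣ p q))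

x∈p─q⇒x∉q : ∀ {n} {x : Fin n} {p q : Subset n} → x ∈ p ─ q → x ∉ q
x∈p─q⇒x∉q {p = _ ∷ _} {q = false ∷ _} here        ()
x∈p─q⇒x∉q {p = _ ∷ _} {q = _ ∷ _}     (there x∈) (there x∈q) = x∈p─q⇒x∉q x∈ x∈q

x∉p⇒∣⁅x⁆∪p∣≡1+∣p∣ : ∀ {n} {x : Fin n} {p : Subset n} → x ∉ p → ∣ ⁅ x ⁆ ∪ p ∣ ≡ suc ∣ p ∣
x∉p⇒∣⁅x⁆∪p∣≡1+∣p∣ {x = x} {p} x∉p =
  trans (∣p∪q∣≡∣p∣+∣q∣ ⁅ x ⁆ p disjoint) (cong (_+ ∣ p ∣) (∣⁅x⁆∣≡1 x))
  where
  disjoint : ∀ {i} → i ∈ ⁅ x ⁆ → i ∈ p → ⊥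
  disjoint i∈⁅x⁆ i∈p = x∉p (subst (_∈ p) (x∈⁅y⁆⇒x≡y x i∈⁅x⁆) i∈p)

x∉p∧y∈p⇒x≢y : ∀ {n} {x y : Fin n} {p : Subset n} → x ∉ p → y ∈ p → x ≢ y
x∉p∧y∈p⇒x≢y x∉p y∈p refl = x∉p y∈p

3≤∣p∣ : ∀ {n} {x y z : Fin n} {p : Subset n} → x ∈ p → y ∈ p → z ∈ p →
  x ≢ y → x ≢ z → y ≢ z → 3 ≤ ∣ p ∣
3≤∣p∣ {x = x} {y} {z} {p} x∈p y∈p z∈p x≢y x≢z y≢z = ≤-trans (s≤s 2≤∣p-x∣) (x∈p⇒∣p-x∣<∣p∣ x∈p)
  where
  1≤∣p-x-y∣ : 1 ≤ ∣ p - x - y ∣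
  1≤∣p-x-y∣ = ≤-trans (s≤s z≤n)
    (x∈p⇒∣p-x∣<∣p∣ (x∈p∧x≢y⇒x∈p-y (x∈p∧x≢y⇒x∈p-y z∈p (x≢z ∘ sym)) (y≢z ∘ sym)))
  2≤∣p-x∣ : 2 ≤ ∣ p - x ∣
  2≤∣p-x∣ = ≤-trans (s≤s 1≤∣p-x-y∣) (x∈p⇒∣p-x∣<∣p∣ (x∈p∧x≢y⇒x∈p-y y∈p (x≢y ∘ sym)))

pairwise-disjoint⇒c*∣S∣+∣T∣≤m :
  ∀ {n m} c (S : Subset n) (B : ∀ {s} → s ∈ S → Subset m) (T : Subset m) →
  (∀ {s} (s∈S : s ∈ S) → c ≤ ∣ B s∈S ∣) →
  (∀ {s s′ p} (s∈S : s ∈ S) (s′∈S : s′ ∈ S) → p ∈ B s∈S → p ∈ B s′∈S → s ≡ s′) →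
  (∀ {s p} (s∈S : s ∈ S) → p ∈ T → p ∈ B s∈S → ⊥) →
  c * ∣ S ∣ + ∣ T ∣ ≤ m
pairwise-disjoint⇒c*∣S∣+∣T∣≤m c [] B T large disjoint T-disjoint =
  ≤-trans (≤-reflexive (cong (_+ ∣ T ∣) (*-zeroʳ c))) (∣p∣≤n T)
pairwise-disjoint⇒c*∣S∣+∣T∣≤m c (false ∷ S) B T large disjoint T-disjoint =
  pairwise-disjoint⇒c*∣S∣+∣T∣≤m c S (B ∘ there) T (large ∘ there)
    (λ s∈S s′∈S → Fin.suc-injective ∘₂ disjoint (there s∈S) (there s′∈S)) (T-disjoint ∘ there)
pairwise-disjoint⇒c*∣S∣+∣T∣≤m {m = m} c (true ∷ S) B T large disjoint T-disjoint = begin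
  c * suc ∣ S ∣ + ∣ T ∣              ≡⟨ shuffle c ∣ S ∣ ∣ T ∣ ⟩
  c * ∣ S ∣ + (∣ T ∣ + c)            ≤⟨ +-monoʳ-≤ (c * ∣ S ∣) (+-monoʳ-≤ ∣ T ∣ (large here)) ⟩
  c * ∣ S ∣ + (∣ T ∣ + ∣ B here ∣)   ≡⟨ cong (c * ∣ S ∣ +_) (∣p∪q∣≡∣p∣+∣q∣ T (B here) (T-disjoint here)) ⟨
  c * ∣ S ∣ + ∣ T ∪ B here ∣         ≤⟨ pairwise-disjoint⇒c*∣S∣+∣T∣≤m c S (B ∘ there) (T ∪ B here) (large ∘ there)
                                         (λ s∈S s′∈S → Fin.suc-injective ∘₂ disjoint (there s∈S) (there s′∈S))
                                         T∪B-here-disjoint ⟩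
  m                                  ∎
  where
  open ≤-Reasoning
  shuffle : ∀ c s t → c * suc s + t ≡ c * s + (t + c)
  shuffle = solve-∀
  T∪B-here-disjoint : ∀ {s p} (s∈S : s ∈ S) → p ∈ T ∪ B here → p ∈ B (there s∈S) → ⊥
  T∪B-here-disjoint s∈S p∈T∪B p∈B with x∈p∪q⁻ T (B here) p∈T∪B
  ... | inj₁ p∈T = T-disjoint (there s∈S) p∈T p∈B
  ... | inj₂ p∈B-here with () ← disjoint here (there s∈S) p∈B-here p∈B

module _ {v k} (D : Steiner3Design v k) where

  module _ {x y z : Fin v} (x≢y : x ≢ y) (x≢z : x ≢ z) (y≢z : y ≢ z) where

    block : Subset v
    block = proj₁ (steiner D x y z x≢y x≢z y≢z)

    block-isBlock : IsBlock D block
    block-isBlock = proj₁ (proj₂ (steiner D x y z x≢y x≢z y≢z))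

    x∈block : x ∈ block
    x∈block = proj₁ (proj₂ (proj₂ (steiner D x y z x≢y x≢z y≢z)))

    y∈block : y ∈ block
    y∈block = proj₁ (proj₂ (proj₂ (proj₂ (steiner D x y z x≢y x≢z y≢z))))

    z∈block : z ∈ block
    z∈block = proj₁ (proj₂ (proj₂ (proj₂ (proj₂ (steiner D x y z x≢y x≢z y≢z)))))

    blocks-agree : ∀ {B C} → IsBlock D B → IsBlock D C →
      x ∈ B → y ∈ B → z ∈ B → x ∈ C → y ∈ C → z ∈ C → B ≡ C
    blocks-agree isB isC xB yB zB xC yC zC = trans (unique _ isB xB yB zB) (sym (unique _ isC xC yC zC))
      where unique = proj₂ (proj₂ (proj₂ (proj₂ (proj₂ (steiner D x y z x≢y x≢z y≢z)))))

  pencil-bound : ∀ {a x} → a ≢ x → (S : Subset v) → a ∉ S → x ∉ S →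
    (∀ {C s s′} → IsBlock D C → a ∈ C → x ∈ C → s ∈ S → s′ ∈ S → s ∈ C → s′ ∈ C → s ≡ s′) →
    (k ∸ 2) * ∣ S ∣ + 2 ≤ v
  pencil-bound {a} {x} a≢x S a∉S x∉S meets-S-once =
    subst (λ t → (k ∸ 2) * ∣ S ∣ + t ≤ v) ∣ends∣≡2
      (pairwise-disjoint⇒c*∣S∣+∣T∣≤m (k ∸ 2) S part ends part-large parts-disjoint ends-disjoint)
    where
    ends : Subset v
    ends = ⁅ a ⁆ ∪ ⁅ x ⁆

    ∣ends∣≡2 : ∣ ends ∣ ≡ 2
    ∣ends∣≡2 = trans (x∉p⇒∣⁅x⁆∪p∣≡1+∣p∣ (x≢y⇒x∉⁅y⁆ a≢x)) (cong suc (∣⁅x⁆∣≡1 x))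

    ∉ends⇒≢a : ∀ {p} → p ∉ ends → a ≢ p
    ∉ends⇒≢a p∉ends refl = p∉ends (x∈p∪q⁺ (inj₁ (x∈⁅x⁆ a)))

    ∉ends⇒≢x : ∀ {p} → p ∉ ends → x ≢ p
    ∉ends⇒≢x p∉ends refl = p∉ends (x∈p∪q⁺ (inj₂ (x∈⁅x⁆ x)))

    module _ {s} (s∈S : s ∈ S) where
      a≢s : a ≢ s
      a≢s = x∉p∧y∈p⇒x≢y a∉S s∈S

      x≢s : x ≢ s
      x≢s = x∉p∧y∈p⇒x≢y x∉S s∈S

      line : Subset v
      line = block a≢x a≢s x≢s

      line-isBlock : IsBlock D line
      line-isBlock = block-isBlock a≢x a≢s x≢s

      a∈line : a ∈ line
      a∈line = x∈block a≢x a≢s x≢s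

      x∈line : x ∈ line
      x∈line = y∈block a≢x a≢s x≢s

      s∈line : s ∈ line
      s∈line = z∈block a≢x a≢s x≢s

      part : Subset v
      part = line ─ ends

      part-large : k ∸ 2 ≤ ∣ part ∣
      part-large = m≤n+o⇒m∸n≤o k 2 (begin
        k                     ≡⟨ sym (block-size D line line-isBlock) ⟩
        ∣ line ∣              ≤⟨ ∣p∣≤∣q∣+∣p─q∣ line ends ⟩
        ∣ ends ∣ + ∣ part ∣   ≡⟨ cong (_+ ∣ part ∣) ∣ends∣≡2 ⟩
        2 + ∣ part ∣          ∎)
        where open ≤-Reasoning

    ends-disjoint : ∀ {s p} (s∈S : s ∈ S) → p ∈ ends → p ∈ part s∈S → ⊥
    ends-disjoint s∈S p∈ends p∈part = x∈p─q⇒x∉q p∈part p∈ends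

    parts-disjoint : ∀ {s s′ p} (s∈S : s ∈ S) (s′∈S : s′ ∈ S) → p ∈ part s∈S → p ∈ part s′∈S → s ≡ s′
    parts-disjoint {p = p} s∈S s′∈S p∈part p∈part′ =
      meets-S-once (line-isBlock s∈S) (a∈line s∈S) (x∈line s∈S) s∈S s′∈S (s∈line s∈S)
        (subst (_ ∈_) (sym line≡line′) (s∈line s′∈S))
      where
      p∉ends : p ∉ ends
      p∉ends = x∈p─q⇒x∉q p∈part
      line≡line′ : line s∈S ≡ line s′∈S
      line≡line′ = blocks-agree a≢x (∉ends⇒≢a p∉ends) (∉ends⇒≢x p∉ends) (line-isBlock s∈S) (line-isBlock s′∈S)
        (a∈line s∈S) (x∈line s∈S) (p─q⊆p _ _ p∈part) (a∈line s′∈S) (x∈line s′∈S) (p─q⊆p _ _ p∈part′)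

∈-image⁺ : ∀ {v} (g : Permutation′ v) {p} {C : Subset v} → p ∈ C → g ⟨$⟩ʳ p ∈ image g C
∈-image⁺ g {p} {C} p∈C = lookup⇒[]= _ (image g C) (begin
  lookup (image g C) (g ⟨$⟩ʳ p)   ≡⟨ lookup∘tabulate (λ q → lookup C (g ⟨$⟩ˡ q)) (g ⟨$⟩ʳ p) ⟩
  lookup C (g ⟨$⟩ˡ (g ⟨$⟩ʳ p))     ≡⟨ cong (lookup C) (inverseˡ g) ⟩
  lookup C p                      ≡⟨ []=⇒lookup p∈C ⟩
  true                            ∎)
  where open ≡-Reasoning

image-fixing-three-points : ∀ {v k} (D : Steiner3Design v k) {g a b c C} → IsAut D g → IsBlock D C →
  a ≢ b → a ≢ c → b ≢ c → a ∈ C → b ∈ C → c ∈ C →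
  g ⟨$⟩ʳ a ≡ a → g ⟨$⟩ʳ b ≡ b → g ⟨$⟩ʳ c ≡ c → image g C ≡ C
image-fixing-three-points D {g} {C = C} isAut isC a≢b a≢c b≢c a∈C b∈C c∈C ga≡a gb≡b gc≡c =
  blocks-agree D a≢b a≢c b≢c (isAut _ isC) isC (fixed a∈C ga≡a) (fixed b∈C gb≡b) (fixed c∈C gc≡c) a∈C b∈C c∈C
  where
  fixed : ∀ {p} → p ∈ C → g ⟨$⟩ʳ p ≡ p → p ∈ image g C
  fixed p∈C gp≡p = subst (_∈ image g C) gp≡p (∈-image⁺ g p∈C)

module _ {v} (H : Permutation′ v → Set) {p q : Fin v} where

  InOrbit-fixedˡ : FixedBy H p → InOrbit H p q → p ≡ q
  InOrbit-fixedˡ p-fixed (h , h∈H , hp≡q) = trans (sym (p-fixed h h∈H)) hp≡q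

  InOrbit-fixedʳ : FixedBy H q → InOrbit H p q → p ≡ q
  InOrbit-fixedʳ q-fixed (h , h∈H , hp≡q) = begin
    p                       ≡⟨ inverseˡ h ⟨
    h ⟨$⟩ˡ (h ⟨$⟩ʳ p)        ≡⟨ cong (h ⟨$⟩ˡ_) (trans hp≡q (sym (q-fixed h h∈H))) ⟩
    h ⟨$⟩ˡ (h ⟨$⟩ʳ q)        ≡⟨ inverseˡ h ⟩
    q                       ∎
    where open ≡-Reasoning

m+n≤o⇒m≤p+[o∸[n+p]] : ∀ {m n o} p → m + n ≤ o → m ≤ p + (o ∸ (n + p))
m+n≤o⇒m≤p+[o∸[n+p]] {m} {n} {o} p m+n≤o = begin
  m                   ≤⟨ m+n≤o⇒m≤o∸n m m+n≤o ⟩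
  o ∸ n               ≤⟨ m≤n+m∸n (o ∸ n) p ⟩
  p + (o ∸ n ∸ p)     ≡⟨ cong (p +_) (∸-+-assoc o n p) ⟩
  p + (o ∸ (n + p))   ∎
  where open ≤-Reasoning

m+m≤1+m*m : ∀ m → m + m ≤ 1 + m * m
m+m≤1+m*m zero    = z≤n
m+m≤1+m*m (suc m) = begin
  suc m + suc m             ≡⟨ lhs m ⟩
  2 + (m + m)               ≤⟨ m≤m+n (2 + (m + m)) (m * m) ⟩
  2 + (m + m) + m * m       ≡⟨ rhs m ⟩
  1 + suc m * suc m         ∎
  where
  open ≤-Reasoning
  lhs : ∀ m → suc m + suc m ≡ 2 + (m + m)
  lhs = solve-∀
  rhs : ∀ m → 2 + (m + m) + m * m ≡ 1 + suc m * suc m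
  rhs = solve-∀

FixedPointBound : ℕ → ℕ → ℕ → Set
FixedPointBound k v f = (k ∸ 2) * f ≤ 2 * (v ∸ k) + (k ∸ 2) * (k ∸ 2)

FixedPointBound-zero : ∀ k v → FixedPointBound k v 0
FixedPointBound-zero k v = ≤-trans (≤-reflexive (*-zeroʳ (k ∸ 2))) z≤n

FixedPointBound-split : ∀ {k v c m} → 3 + c ≤ k → (k ∸ 2) * m + 2 ≤ v → FixedPointBound k v (c + m)
FixedPointBound-split {suc (suc K)} {v} {c} {m} (s≤s (s≤s c<K)) pencil = begin
  K * (c + m)            ≡⟨ *-distribˡ-+ K c m ⟩
  K * c + K * m          ≤⟨ +-monoʳ-≤ (K * c) (m+n≤o⇒m≤p+[o∸[n+p]] K pencil) ⟩
  K * c + (K + t)        ≡⟨ regroup K c t ⟩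
  K * suc c + t          ≤⟨ +-monoˡ-≤ t (*-monoʳ-≤ K c<K) ⟩
  K * K + t              ≤⟨ +-monoʳ-≤ (K * K) (m≤m+n t (t + 0)) ⟩
  K * K + 2 * t          ≡⟨ +-comm (K * K) (2 * t) ⟩
  2 * t + K * K          ∎
  where
  open ≤-Reasoning
  t : ℕ
  t = v ∸ suc (suc K)
  regroup : ∀ K c t → K * c + (K + t) ≡ K * suc c + t
  regroup = solve-∀

FixedPointBound-off-block : ∀ {k v f g} → f ≤ 1 + g → k < v → (k ∸ 2) * g + 2 ≤ v → FixedPointBound k v f
FixedPointBound-off-block {zero}          _ _ _ = z≤n
FixedPointBound-off-block {suc zero}      _ _ _ = z≤n
FixedPointBound-off-block {suc (suc K)} {v} {f} {g} f≤1+g k<v pencil = begin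
  K * f                  ≤⟨ *-monoʳ-≤ K f≤1+g ⟩
  K * suc g              ≡⟨ *-suc K g ⟩
  K + K * g              ≤⟨ +-monoʳ-≤ K (m+n≤o⇒m≤p+[o∸[n+p]] K pencil) ⟩
  K + (K + t)            ≡⟨ +-assoc K K t ⟨
  (K + K) + t            ≤⟨ +-monoˡ-≤ t (m+m≤1+m*m K) ⟩
  (1 + K * K) + t        ≤⟨ +-monoˡ-≤ t (+-monoˡ-≤ (K * K) (m<n⇒0<n∸m k<v)) ⟩
  (t + K * K) + t        ≡⟨ regroup t (K * K) ⟩
  2 * t + K * K          ∎
  where
  open ≤-Reasoning
  t : ℕ
  t = v ∸ suc (suc K)
  regroup : ∀ t s → (t + s) + t ≡ 2 * t + s
  regroup = solve-∀

module FixedPoints {v k} (D : Steiner3Design v k) (H : Permutation′ v → Set)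
  (H-aut : ∀ h → H h → IsAut D h) (F : Subset v) (F-fixed : ∀ p → p ∈ F → FixedBy H p)
  {x y z : Fin v} (x→y : InOrbit H x y) (x→z : InOrbit H x z)
  (x≢y : x ≢ y) (x≢z : x ≢ z) (y≢z : y ≢ z) where

  B₀ : Subset v
  B₀ = block D x≢y x≢z y≢z

  x∉F : x ∉ F
  x∉F x∈F = x≢y (InOrbit-fixedˡ H (F-fixed x x∈F) x→y)

  y∉F : y ∉ F
  y∉F y∈F = x≢y (InOrbit-fixedʳ H (F-fixed y y∈F) x→y)

  z∉F : z ∉ F
  z∉F z∈F = x≢z (InOrbit-fixedʳ H (F-fixed z z∈F) x→z)

  block-through-x-and-three-points-of-F≡B₀ : ∀ {C a b c} → IsBlock D C → x ∈ C →
    a ≢ b → a ≢ c → b ≢ c → a ∈ F → b ∈ F → c ∈ F → a ∈ C → b ∈ C → c ∈ C → C ≡ B₀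
  block-through-x-and-three-points-of-F≡B₀ {C} isC x∈C a≢b a≢c b≢c a∈F b∈F c∈F a∈C b∈C c∈C =
    blocks-agree D x≢y x≢z y≢z isC (block-isBlock D x≢y x≢z y≢z)
      x∈C (orbit⊆C x→y) (orbit⊆C x→z)
      (x∈block D x≢y x≢z y≢z) (y∈block D x≢y x≢z y≢z) (z∈block D x≢y x≢z y≢z)
    where
    orbit⊆C : ∀ {q} → InOrbit H x q → q ∈ C
    orbit⊆C (h , h∈H , hx≡q) = subst (_∈ C) hx≡q (subst (h ⟨$⟩ʳ x ∈_) hC≡C (∈-image⁺ h x∈C))
      where
      hC≡C : image h C ≡ C
      hC≡C = image-fixing-three-points D {g = h} (H-aut h h∈H) isC a≢b a≢c b≢c a∈C b∈C c∈C
        (F-fixed _ a∈F h h∈H) (F-fixed _ b∈F h h∈H) (F-fixed _ c∈F h h∈H)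

  pencil-bound-in-F : ∀ {a} → a ∈ F → (S : Subset v) → S ⊆ F → a ∉ S →
    (∀ {s} → s ∈ S → a ∈ B₀ → s ∈ B₀ → ⊥) → (k ∸ 2) * ∣ S ∣ + 2 ≤ v
  pencil-bound-in-F {a} a∈F S S⊆F a∉S B₀-separates = pencil-bound D a≢x S a∉S (x∉F ∘ S⊆F) meets-S-once
    where
    a≢x : a ≢ x
    a≢x refl = x∉F a∈F
    meets-S-once : ∀ {C s s′} → IsBlock D C → a ∈ C → x ∈ C → s ∈ S → s′ ∈ S → s ∈ C → s′ ∈ C → s ≡ s′
    meets-S-once {C} {s} {s′} isC a∈C x∈C s∈S s′∈S s∈C s′∈C with s ≟ s′
    ... | yes s≡s′ = s≡s′
    ... | no s≢s′  = contradiction (subst (s ∈_) C≡B₀ s∈C) (B₀-separates s∈S (subst (a ∈_) C≡B₀ a∈C))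
      where
      C≡B₀ : C ≡ B₀
      C≡B₀ = block-through-x-and-three-points-of-F≡B₀ isC x∈C
        (x∉p∧y∈p⇒x≢y a∉S s∈S) (x∉p∧y∈p⇒x≢y a∉S s′∈S) s≢s′ a∈F (S⊆F s∈S) (S⊆F s′∈S) a∈C s∈C s′∈C

  3+∣F∩B₀∣≤k : 3 + ∣ F ∩ B₀ ∣ ≤ k
  3+∣F∩B₀∣≤k = begin
    3 + ∣ F ∩ B₀ ∣             ≤⟨ +-monoˡ-≤ ∣ F ∩ B₀ ∣ (3≤∣p∣ x∈B₀─F y∈B₀─F z∈B₀─F x≢y x≢z y≢z) ⟩
    ∣ B₀ ─ F ∣ + ∣ F ∩ B₀ ∣    ≡⟨ cong (∣ B₀ ─ F ∣ +_) (cong ∣_∣ (∩-comm F B₀)) ⟩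
    ∣ B₀ ─ F ∣ + ∣ B₀ ∩ F ∣    ≡⟨ +-comm ∣ B₀ ─ F ∣ ∣ B₀ ∩ F ∣ ⟩
    ∣ B₀ ∩ F ∣ + ∣ B₀ ─ F ∣    ≡⟨ ∣p∣≡∣p∩q∣+∣p─q∣ B₀ F ⟨
    ∣ B₀ ∣                     ≡⟨ block-size D B₀ (block-isBlock D x≢y x≢z y≢z) ⟩
    k                          ∎
    where
    open ≤-Reasoning
    x∈B₀─F : x ∈ B₀ ─ F
    x∈B₀─F = x∈p∧x∉q⇒x∈p─q (x∈block D x≢y x≢z y≢z) x∉F
    y∈B₀─F : y ∈ B₀ ─ F
    y∈B₀─F = x∈p∧x∉q⇒x∈p─q (y∈block D x≢y x≢z y≢z) y∉F
    z∈B₀─F : z ∈ B₀ ─ F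
    z∈B₀─F = x∈p∧x∉q⇒x∈p─q (z∈block D x≢y x≢z y≢z) z∉F

  1+k≤v : ∀ {a} → a ∉ B₀ → 1 + k ≤ v
  1+k≤v {a} a∉B₀ = begin
    1 + k                 ≡⟨ cong suc (block-size D B₀ (block-isBlock D x≢y x≢z y≢z)) ⟨
    suc ∣ B₀ ∣            ≡⟨ x∉p⇒∣⁅x⁆∪p∣≡1+∣p∣ a∉B₀ ⟨
    ∣ ⁅ a ⁆ ∪ B₀ ∣        ≤⟨ ∣p∣≤n (⁅ a ⁆ ∪ B₀) ⟩
    v                     ∎
    where open ≤-Reasoning

  bound-if-F-meets-B₀ : ∀ {a} → a ∈ F → a ∈ B₀ → FixedPointBound k v ∣ F ∣
  bound-if-F-meets-B₀ a∈F a∈B₀ =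
    subst (FixedPointBound k v) (sym (∣p∣≡∣p∩q∣+∣p─q∣ F B₀))
      (FixedPointBound-split 3+∣F∩B₀∣≤k
        (pencil-bound-in-F a∈F (F ─ B₀) (p─q⊆p F B₀)
          (λ a∈F─B₀ → x∈p─q⇒x∉q a∈F─B₀ a∈B₀) (λ s∈F─B₀ _ → x∈p─q⇒x∉q s∈F─B₀)))

  bound-if-F-misses-B₀ : ∀ {a} → a ∈ F → (∀ {p} → p ∈ F → p ∉ B₀) → FixedPointBound k v ∣ F ∣
  bound-if-F-misses-B₀ {a} a∈F F-misses-B₀ =
    FixedPointBound-off-block ∣F∣≤1+∣F-a∣ (1+k≤v (F-misses-B₀ a∈F))
      (pencil-bound-in-F a∈F (F - a) (p─q⊆p F ⁅ a ⁆)
        (λ a∈F-a → x∈p─q⇒x∉q a∈F-a (x∈⁅x⁆ a)) (λ _ a∈B₀ _ → F-misses-B₀ a∈F a∈B₀))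
    where
    ∣F∣≤1+∣F-a∣ : ∣ F ∣ ≤ 1 + ∣ F - a ∣
    ∣F∣≤1+∣F-a∣ = ≤-trans (∣p∣≤∣q∣+∣p─q∣ F ⁅ a ⁆) (≤-reflexive (cong (_+ ∣ F - a ∣) (∣⁅x⁆∣≡1 a)))

  fixed-point-bound : FixedPointBound k v ∣ F ∣
  fixed-point-bound with nonempty? (F ∩ B₀) | nonempty? F
  ... | yes (a , a∈F∩B₀) | _ = bound-if-F-meets-B₀ (proj₁ (x∈p∩q⁻ F B₀ a∈F∩B₀)) (proj₂ (x∈p∩q⁻ F B₀ a∈F∩B₀))
  ... | no F∩B₀-empty | yes (a , a∈F) =
    bound-if-F-misses-B₀ a∈F (λ p∈F p∈B₀ → F∩B₀-empty (_ , x∈p∩q⁺ (p∈F , p∈B₀)))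
  ... | no _ | no F-empty =
    subst (FixedPointBound k v) (sym (trans (cong ∣_∣ (Empty-unique F-empty)) (∣⊥∣≡0 v))) (FixedPointBound-zero k v)

lemma3p2 : (v k : ℕ) (D : Steiner3Design v k)
    (G H : Permutation′ v → Set) →
    IsSubgroup G → (∀ g → G g → IsAut D g) → BlockTransitive D G →
    IsSubgroup H → H ⊆ᴳ G → Nontrivial H → HasOrbit≥3 H →
    (F : Subset v) → (∀ x → x ∈ F → FixedBy H x) →
    (k ∸ 2) * ∣ F ∣ ≤ 2 * (v ∸ k) + (k ∸ 2) * (k ∸ 2)
lemma3p2 v k D G H _ G-aut _ _ H⊆G _ (x , y , z , x→y , x→z , x≢y , x≢z , y≢z) F F-fixed =
  FixedPoints.fixed-point-bound D H (λ h h∈H → G-aut h (H⊆G h h∈H)) F F-fixed x→y x→z x≢y x≢z y≢z
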